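{- Let $G$ be a finite bipartite graph with parts $U$ and $V$, such that every vertex of $U$ has degree at least $1$, and let $\Delta_V$ be the maximum degree of a vertex in $V$. Suppose there is no matching in $G$ saturating $U$. Then there exist nonempty subsets $U_1\subseteq U$ and $V_1\subseteq V$ such that $G$ contains a perfect matching between $U_1$ and $V_1$, and \[ e(U_1,V)+e(U\setminus U_1,V_1)\le |U_1|\,\Delta_V. \]
   Context: For $X\subseteq U$ and $Y\subseteq V$, $e(X,Y)$ denotes the number of edges of $G$ with one endpoint in $X$ and the other in $Y$. -}

module Defs where

open import Data.Nat using (ℕ; zero; suc; _+_; _*_; _⊔_; _≤_)
open import Data.Bool using (Bool; true; false; if_then_else_)
open import Data.Fin using (Fin)
open import Data.Fin.Subset using (Subset; _∈_; _∉_; ∣_∣; Nonempty; ∁; ⊤)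
open import Data.Vec using (lookup)
open import Data.Vec.Functional using () renaming (foldr to vfoldr)
open import Data.Product using (Σ; ∃; _×_)
open import Relation.Binary.PropositionalEquality using (_≡_)

-- A finite (simple) bipartite graph with parts U = Fin m and V = Fin n,
-- given by its biadjacency relation: adj u v ≡ true iff uv is an edge.
BipGraph : ℕ → ℕ → Set
BipGraph m n = Fin m → Fin n → Bool

sumFin : ∀ {k} → (Fin k → ℕ) → ℕ
sumFin {k} f = vfoldr _+_ 0 f

-- maximum over Fin k (0 if k = 0)
maxFin : ∀ {k} → (Fin k → ℕ) → ℕ
maxFin {k} f = vfoldr _⊔_ 0 f

b2n : Bool → ℕ
b2n true = 1
b2n false = 0

module _ {m n : ℕ} (G : BipGraph m n) where

  degU : Fin m → ℕ
  degU u = sumFin (λ v → b2n (G u v))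

  degV : Fin n → ℕ
  degV v = sumFin (λ u → b2n (G u v))

  ΔV : ℕ
  ΔV = maxFin degV

  ind : ∀ {k} → Subset k → Fin k → ℕ
  ind p i = b2n (lookup p i)

  e : Subset m → Subset n → ℕ
  e X Y = sumFin (λ u → sumFin (λ v → ind X u * ind Y v * b2n (G u v)))

  allV : Subset n
  allV = ⊤

  SaturatingMatching : Set
  SaturatingMatching =
    Σ (Fin m → Fin n) λ f →
      (∀ u → G u (f u) ≡ true) × (∀ u u′ → f u ≡ f u′ → u ≡ u′)

  PerfectMatchingBetween : Subset m → Subset n → Set
  PerfectMatchingBetween U₁ V₁ =
    Σ (Fin m → Fin n) λ f →
      (∀ u → u ∈ U₁ → f u ∈ V₁ × G u (f u) ≡ true)
      × (∀ u u′ → u ∈ U₁ → u′ ∈ U₁ → f u ≡ f u′ → u ≡ u′)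
      × (∀ v → v ∈ V₁ → ∃ λ u → u ∈ U₁ × f u ≡ v)

-- Build a matching of U one vertex at a time. To add an unmatched vertex u₀, grow the
-- Hungarian tree R of vertices of U reachable from u₀ by alternating paths. Either some
-- tree vertex has a neighbour that is not matched at all, and flipping the alternating
-- path to it gives a larger matching, or every neighbour of R is matched into R ∖ {u₀}.
-- In the second case U₁ = R ∖ {u₀} is matched onto V₁ = f[U₁] ⊇ N(U₁), and U₁ is nonempty
-- because u₀ has a neighbour. Then e(U₁,V) + e(U∖U₁,V₁) = e(U,V₁) = Σ_{v∈V₁} deg v, and
-- each v = f u contributes at most Δ_V, for |U₁| terms in total.
module Submission where

open import Defs
open import Data.Nat using (ℕ; zero; suc; _+_; _*_; _≤_; _<_; z≤n)
open import Data.Nat.Properties hiding (_≟_)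
open import Data.Bool using (Bool; true; false; not)
open import Data.Bool.Properties using () renaming (_≟_ to _≟ᵇ_)
open import Data.Fin using (Fin; zero; suc)
open import Data.Fin.Properties using (_≟_; any?)
open import Data.Fin.Subset
  using (Subset; Nonempty; _∈_; _∉_; _⊆_; _∪_; _─_; _-_; ⁅_⁆; ⊥; ∁; ∣_∣; inside; outside)
open import Data.Fin.Subset.Properties
  using ( _∈?_; nonempty?; ∉⊥; x∈⁅x⁆; x∈⁅y⁆⇒x≡y; x∈p∪q⁺; x∈p∪q⁻; p⊆p∪q; q⊆p∪q; p─q⊆p
        ; x∈p∧x≢y⇒x∈p-y; x∉∁p⇒x∈p; x∈∁p⇒x∉p; p⊂q⇒∣p∣<∣q∣; ∣p∣≤n)
open import Data.Vec using ([]; _∷_; lookup; tabulate; there)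
open import Data.Vec.Properties using (lookup∘tabulate; lookup-map; lookup-replicate; []=⇒lookup; lookup⇒[]=)
open import Data.Vec.Functional using (updateAt)
open import Data.Vec.Functional.Properties using (updateAt-updates; updateAt-minimal)
open import Data.Product using (Σ; ∃; _×_; _,_; proj₁; proj₂)
open import Data.Sum using (_⊎_; inj₁; inj₂)
open import Data.Empty using (⊥-elim)
open import Function using (const)
open import Level using (0ℓ)
open import Relation.Nullary using (Dec; yes; no; does; ¬_)
open import Relation.Nullary.Decidable using (dec-true; _×-dec_; ¬?; decidable-stable)
open import Relation.Unary using (Pred; Decidable)
open import Relation.Binary.PropositionalEquality
open import Algebra.Properties.Semiring.Sum +-*-semiring
  using (sum-replicate-zero; sum-cong-≗; ∑-distrib-+; ∑-comm; *-distribˡ-sum; *-distribʳ-sum)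

𝟙 : ∀ {k} → Subset k → Fin k → ℕ
𝟙 p i = b2n (lookup p i)

sum-mono-≤ : ∀ {k} {f g : Fin k → ℕ} → (∀ i → f i ≤ g i) → sumFin f ≤ sumFin g
sum-mono-≤ {zero} f≤g = z≤n
sum-mono-≤ {suc k} f≤g = +-mono-≤ (f≤g zero) (sum-mono-≤ (λ i → f≤g (suc i)))

term≤sum : ∀ {k} (f : Fin k → ℕ) i → f i ≤ sumFin f
term≤sum f zero = m≤m+n _ _
term≤sum f (suc i) = ≤-trans (term≤sum (λ j → f (suc j)) i) (m≤n+m _ (f zero))

sum-δ : ∀ {k} (i : Fin k) (h : Fin k → ℕ) → sumFin (λ j → b2n (does (i ≟ j)) * h j) ≡ h i
sum-δ {suc k} zero h = begin
  1 * h zero + sumFin (λ j → 0 * h (suc j)) ≡⟨ cong (1 * h zero +_) (sum-replicate-zero k) ⟩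
  1 * h zero + 0                            ≡⟨ +-identityʳ _ ⟩
  1 * h zero                                ≡⟨ *-identityˡ _ ⟩
  h zero                                    ∎
  where open ≡-Reasoning
sum-δ {suc k} (suc i) h = sum-δ i (λ j → h (suc j))

∣p∣≡∑𝟙 : ∀ {k} (p : Subset k) → ∣ p ∣ ≡ sumFin (𝟙 p)
∣p∣≡∑𝟙 [] = refl
∣p∣≡∑𝟙 (inside ∷ p) = cong suc (∣p∣≡∑𝟙 p)
∣p∣≡∑𝟙 (outside ∷ p) = ∣p∣≡∑𝟙 p

max-ub : ∀ {k} (f : Fin k → ℕ) i → f i ≤ maxFin f
max-ub f zero = m≤m⊔n _ _
max-ub f (suc i) = ≤-trans (max-ub (λ j → f (suc j)) i) (m≤n⊔m (f zero) _)

1≤∑b2n⇒∃ : ∀ {k} (p : Fin k → Bool) → 1 ≤ sumFin (λ i → b2n (p i)) → ∃ λ i → p i ≡ true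
1≤∑b2n⇒∃ {suc k} p 1≤∑ with p zero in p₀
... | true = zero , p₀
... | false with 1≤∑b2n⇒∃ (λ i → p (suc i)) 1≤∑
...   | i , pᵢ = suc i , pᵢ

x∈p─q⇒x∉q : ∀ {k} {x : Fin k} (p q : Subset k) → x ∈ p ─ q → x ∉ q
x∈p─q⇒x∉q (_ ∷ p) (outside ∷ q) (there x∈) (there x∈q) = x∈p─q⇒x∉q p q x∈ x∈q
x∈p─q⇒x∉q (_ ∷ p) (inside ∷ q) (there x∈) (there x∈q) = x∈p─q⇒x∉q p q x∈ x∈q

x∈p-y⇒x≢y : ∀ {k} {x y : Fin k} (p : Subset k) → x ∈ p - y → x ≢ y
x∈p-y⇒x≢y {y = y} p x∈ refl = x∈p─q⇒x∉q p ⁅ y ⁆ x∈ (x∈⁅x⁆ y)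

x∉p⇒∣p∣<∣p∪⁅x⁆∣ : ∀ {k} {x : Fin k} {p : Subset k} → x ∉ p → ∣ p ∣ < ∣ p ∪ ⁅ x ⁆ ∣
x∉p⇒∣p∣<∣p∪⁅x⁆∣ {x = x} x∉p = p⊂q⇒∣p∣<∣q∣ (p⊆p∪q ⁅ x ⁆ , x , x∈p∪q⁺ (inj₂ (x∈⁅x⁆ x)) , x∉p)

module _ {k} {P : Pred (Fin k) 0ℓ} (P? : Decidable P) where

  ∈-tabulate⁺ : ∀ {i} → P i → i ∈ tabulate (λ j → does (P? j))
  ∈-tabulate⁺ {i} Pi = lookup⇒[]= i _ (trans (lookup∘tabulate _ i) (dec-true (P? i) Pi))

  ∈-tabulate⁻ : ∀ {i} → i ∈ tabulate (λ j → does (P? j)) → P i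
  ∈-tabulate⁻ {i} i∈ with P? i | trans (sym (lookup∘tabulate (λ j → does (P? j)) i)) ([]=⇒lookup i∈)
  ... | yes Pi | _ = Pi

module _ {m n} (f : Fin m → Fin n) (S : Subset m) where

  Image : Pred (Fin n) 0ℓ
  Image v = ∃ λ u → u ∈ S × f u ≡ v

  image? : Decidable Image
  image? v = any? (λ u → u ∈? S ×-dec f u ≟ v)

  image : Subset n
  image = tabulate (λ v → does (image? v))

  ∈-image⁺ : ∀ {u} → u ∈ S → f u ∈ image
  ∈-image⁺ {u} u∈S = ∈-tabulate⁺ image? (u , u∈S , refl)

  ∈-image⁻ : ∀ {v} → v ∈ image → Image v
  ∈-image⁻ = ∈-tabulate⁻ image?

  ∑𝟙image≤ : (h : Fin n → ℕ) → sumFin (λ v → 𝟙 image v * h v) ≤ sumFin (λ u → 𝟙 S u * h (f u))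
  ∑𝟙image≤ h = begin
    sumFin (λ v → 𝟙 image v * h v)
      ≤⟨ sum-mono-≤ covered ⟩
    sumFin (λ v → sumFin (λ u → 𝟙 S u * hit u v))
      ≡⟨ ∑-comm (λ v u → 𝟙 S u * hit u v) ⟩
    sumFin (λ u → sumFin (λ v → 𝟙 S u * hit u v))
      ≡⟨ sum-cong-≗ (λ u → *-distribˡ-sum (𝟙 S u) (hit u)) ⟨
    sumFin (λ u → 𝟙 S u * sumFin (hit u))
      ≡⟨ sum-cong-≗ (λ u → cong (𝟙 S u *_) (sum-δ (f u) h)) ⟩
    sumFin (λ u → 𝟙 S u * h (f u)) ∎
    where
    open ≤-Reasoning
    hit : Fin m → Fin n → ℕ
    hit u v = b2n (does (f u ≟ v)) * h v
    covered : ∀ v → 𝟙 image v * h v ≤ sumFin (λ u → 𝟙 S u * hit u v)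
    covered v with lookup image v in v∈?
    ... | false = z≤n
    ... | true with ∈-image⁻ (lookup⇒[]= v image v∈?)
    ...   | u , u∈S , refl = ≤-trans (≤-reflexive (sym u-term)) (term≤sum _ u)
      where
      u-term : 𝟙 S u * hit u (f u) ≡ 1 * h (f u)
      u-term rewrite []=⇒lookup u∈S | dec-true (f u ≟ f u) refl = *-identityˡ (1 * h (f u))

module _ {S A : Set} (size : S → ℕ) (bound : ℕ) (size≤bound : ∀ s → size s ≤ bound)
         (step : ∀ s → A ⊎ ∃ λ s′ → size s < size s′) where

  iterate : S → A
  iterate s = run bound s (m≤n+m bound (size s))
    where
    run : ∀ fuel s → bound ≤ size s + fuel → A
    run fuel s bound≤ with step s
    ... | inj₁ a = a
    run zero s bound≤ | inj₂ (s′ , grows) = ⊥-elim (<-irrefl refl (begin-strict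
      size s        <⟨ grows ⟩
      size s′       ≤⟨ size≤bound s′ ⟩
      bound         ≤⟨ bound≤ ⟩
      size s + zero ≡⟨ +-identityʳ (size s) ⟩
      size s        ∎))
      where open ≤-Reasoning
    run (suc fuel) s bound≤ | inj₂ (s′ , grows) = run fuel s′ (begin
      bound               ≤⟨ bound≤ ⟩
      size s + suc fuel   ≡⟨ +-suc (size s) fuel ⟩
      suc (size s) + fuel ≤⟨ +-monoˡ-≤ fuel grows ⟩
      size s′ + fuel      ∎)
      where open ≤-Reasoning

neighbour-term≤ : ∀ (a x g : Bool) → (a ≡ true → g ≡ true → x ≡ true) →
  b2n a * 1 * b2n g + b2n (not a) * b2n x * b2n g ≤ b2n x * b2n g
neighbour-term≤ true x true closed rewrite closed refl refl = ≤-refl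
neighbour-term≤ true x false closed = z≤n
neighbour-term≤ false x g closed = ≤-reflexive (cong (_* b2n g) (*-identityˡ (b2n x)))

module _ {m n} (G : BipGraph m n) where

  e+e≤∑deg : (U₁ : Subset m) (V₁ : Subset n) → (∀ {u v} → u ∈ U₁ → G u v ≡ true → v ∈ V₁) →
    e G U₁ (allV G) + e G (∁ U₁) V₁ ≤ sumFin (λ v → 𝟙 V₁ v * degV G v)
  e+e≤∑deg U₁ V₁ closed = begin
    e G U₁ (allV G) + e G (∁ U₁) V₁
      ≡⟨ ∑-distrib-+ (λ u → sumFin (a u)) (λ u → sumFin (b u)) ⟨
    sumFin (λ u → sumFin (a u) + sumFin (b u))
      ≡⟨ sum-cong-≗ (λ u → ∑-distrib-+ (a u) (b u)) ⟨
    sumFin (λ u → sumFin (λ v → a u v + b u v))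
      ≤⟨ sum-mono-≤ (λ u → sum-mono-≤ (pointwise u)) ⟩
    sumFin (λ u → sumFin (λ v → 𝟙 V₁ v * b2n (G u v)))
      ≡⟨ ∑-comm (λ u v → 𝟙 V₁ v * b2n (G u v)) ⟩
    sumFin (λ v → sumFin (λ u → 𝟙 V₁ v * b2n (G u v)))
      ≡⟨ sum-cong-≗ (λ v → *-distribˡ-sum (𝟙 V₁ v) (λ u → b2n (G u v))) ⟨
    sumFin (λ v → 𝟙 V₁ v * degV G v) ∎
    where
    open ≤-Reasoning
    a b : Fin m → Fin n → ℕ
    a u v = 𝟙 U₁ u * 𝟙 (allV G) v * b2n (G u v)
    b u v = 𝟙 (∁ U₁) u * 𝟙 V₁ v * b2n (G u v)
    pointwise : ∀ u v → a u v + b u v ≤ 𝟙 V₁ v * b2n (G u v)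
    pointwise u v rewrite lookup-replicate {n = n} v true | lookup-map u not U₁ =
      neighbour-term≤ (lookup U₁ u) (lookup V₁ v) (G u v)
        (λ u∈ uv → []=⇒lookup (closed (lookup⇒[]= u U₁ u∈) uv))

  record IsMatching (S : Subset m) (f : Fin m → Fin n) : Set where
    field
      along-edges : ∀ {u} → u ∈ S → G u (f u) ≡ true
      injective : ∀ {u u′} → u ∈ S → u′ ∈ S → f u ≡ f u′ → u ≡ u′

  open IsMatching

  IsMatching-⊆ : ∀ {S T f} → T ⊆ S → IsMatching S f → IsMatching T f
  IsMatching-⊆ T⊆S M = record
    { along-edges = λ u∈T → along-edges M (T⊆S u∈T)
    ; injective = λ u∈T u′∈T → injective M (T⊆S u∈T) (T⊆S u′∈T)
    }

  IsMatching-update : ∀ {S T g u v} → IsMatching S g → G u v ≡ true →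
    (∀ {w} → w ∈ T → w ≢ u → w ∈ S × g w ≢ v) → IsMatching T (updateAt g u (const v))
  IsMatching-update {S} {T} {g} {u} {v} M uv old =
    record { along-edges = edge ; injective = inj }
    where
    g′ : Fin m → Fin n
    g′ = updateAt g u (const v)
    g′-u : g′ u ≡ v
    g′-u = updateAt-updates u g
    g′-w : ∀ {w} → w ≢ u → g′ w ≡ g w
    g′-w w≢u = updateAt-minimal _ u g w≢u
    edge : ∀ {w} → w ∈ T → G w (g′ w) ≡ true
    edge {w} w∈T with w ≟ u
    ... | yes refl rewrite g′-u = uv
    ... | no w≢u rewrite g′-w w≢u = along-edges M (proj₁ (old w∈T w≢u))
    inj : ∀ {w w′} → w ∈ T → w′ ∈ T → g′ w ≡ g′ w′ → w ≡ w′
    inj {w} {w′} w∈T w′∈T g′w≡g′w′ with w ≟ u | w′ ≟ u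
    ... | yes refl | yes refl = refl
    ... | yes refl | no w′≢u =
      ⊥-elim (proj₂ (old w′∈T w′≢u) (trans (sym (g′-w w′≢u)) (trans (sym g′w≡g′w′) g′-u)))
    ... | no w≢u | yes refl =
      ⊥-elim (proj₂ (old w∈T w≢u) (trans (sym (g′-w w≢u)) (trans g′w≡g′w′ g′-u)))
    ... | no w≢u | no w′≢u =
      injective M (proj₁ (old w∈T w≢u)) (proj₁ (old w′∈T w′≢u))
        (trans (sym (g′-w w≢u)) (trans g′w≡g′w′ (g′-w w′≢u)))

  record TightSet : Set where
    field
      U₁ : Subset m
      match : Fin m → Fin n
      nonempty : Nonempty U₁
      isMatching : IsMatching U₁ match
      closed : ∀ {u v} → u ∈ U₁ → G u v ≡ true → v ∈ image match U₁

  module _ (T : TightSet) where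
    open TightSet T

    perfectMatchingOntoImage : PerfectMatchingBetween G U₁ (image match U₁)
    perfectMatchingOntoImage =
      match , (λ u u∈U₁ → ∈-image⁺ match U₁ u∈U₁ , along-edges isMatching u∈U₁)
            , (λ u u′ → injective isMatching)
            , (λ v → ∈-image⁻ match U₁)

    image-nonempty : Nonempty (image match U₁)
    image-nonempty = match (proj₁ nonempty) , ∈-image⁺ match U₁ (proj₂ nonempty)

    e+e≤∣U₁∣*ΔV : e G U₁ (allV G) + e G (∁ U₁) (image match U₁) ≤ ∣ U₁ ∣ * ΔV G
    e+e≤∣U₁∣*ΔV = begin
      e G U₁ (allV G) + e G (∁ U₁) (image match U₁)  ≤⟨ e+e≤∑deg U₁ (image match U₁) closed ⟩
      sumFin (λ v → 𝟙 (image match U₁) v * degV G v) ≤⟨ ∑𝟙image≤ match U₁ (degV G) ⟩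
      sumFin (λ u → 𝟙 U₁ u * degV G (match u))       ≤⟨ sum-mono-≤ deg≤ΔV ⟩
      sumFin (λ u → 𝟙 U₁ u * ΔV G)                   ≡⟨ *-distribʳ-sum (ΔV G) (𝟙 U₁) ⟨
      sumFin (𝟙 U₁) * ΔV G                           ≡⟨ cong (_* ΔV G) (∣p∣≡∑𝟙 U₁) ⟨
      ∣ U₁ ∣ * ΔV G                                  ∎
      where
      open ≤-Reasoning
      deg≤ΔV : ∀ u → 𝟙 U₁ u * degV G (match u) ≤ 𝟙 U₁ u * ΔV G
      deg≤ΔV u = *-monoʳ-≤ (𝟙 U₁ u) (max-ub (degV G) (match u))

module Augmenting {m n} (G : BipGraph m n) (D : Subset m) (f : Fin m → Fin n)
  (f-matching : IsMatching G D f) (u₀ : Fin m) (u₀∉D : u₀ ∉ D)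
  (v₀ : Fin n) (u₀v₀ : G u₀ v₀ ≡ true) where

  open IsMatching

  D⁺ : Subset m
  D⁺ = D ∪ ⁅ u₀ ⁆

  ∈D⁺⇒≢u₀⇒∈D : ∀ {w} → w ∈ D⁺ → w ≢ u₀ → w ∈ D
  ∈D⁺⇒≢u₀⇒∈D {w} w∈D⁺ w≢u₀ with x∈p∪q⁻ D ⁅ u₀ ⁆ w∈D⁺
  ... | inj₁ w∈D = w∈D
  ... | inj₂ w∈⁅u₀⁆ = ⊥-elim (w≢u₀ (x∈⁅y⁆⇒x≡y u₀ w∈⁅u₀⁆))

  ∈D⇒≢u₀ : ∀ {w} → w ∈ D → w ≢ u₀
  ∈D⇒≢u₀ w∈D refl = u₀∉D w∈D

  -- g is f with the alternating path from u₀ to the tree vertex u flipped.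
  record Alternating (R : Subset m) (u : Fin m) : Set where
    field
      g : Fin m → Fin n
      g-matching : IsMatching G (D⁺ - u) g
      g-into-f[D] : ∀ {w} → w ∈ D⁺ - u → g w ∈ image f D
      g-agrees : ∀ {w} → w ∈ D → w ∉ R → g w ≡ f w

  record Tree : Set where
    field
      R : Subset m
      R⊆D⁺ : R ⊆ D⁺
      root : u₀ ∈ R
      alternating : ∀ {u} → u ∈ R → Alternating R u

  open Tree

  Outcome : Set
  Outcome = (∃ λ h → IsMatching G D⁺ h) ⊎ TightSet G

  initial : Tree
  initial = record
    { R = ⁅ u₀ ⁆
    ; R⊆D⁺ = q⊆p∪q D ⁅ u₀ ⁆
    ; root = x∈⁅x⁆ u₀
    ; alternating = λ u∈⁅u₀⁆ → subst (Alternating ⁅ u₀ ⁆) (sym (x∈⁅y⁆⇒x≡y u₀ u∈⁅u₀⁆)) unflipped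
    }
    where
    D⁺-u₀⊆D : D⁺ - u₀ ⊆ D
    D⁺-u₀⊆D w∈ = ∈D⁺⇒≢u₀⇒∈D (p─q⊆p D⁺ ⁅ u₀ ⁆ w∈) (x∈p-y⇒x≢y D⁺ w∈)
    unflipped : Alternating ⁅ u₀ ⁆ u₀
    unflipped = record
      { g = f
      ; g-matching = IsMatching-⊆ G D⁺-u₀⊆D f-matching
      ; g-into-f[D] = λ w∈ → ∈-image⁺ f D (D⁺-u₀⊆D w∈)
      ; g-agrees = λ _ _ → refl
      }

  module _ {R : Subset m} {u : Fin m} (alt : Alternating R u) {v : Fin n} (uv : G u v ≡ true) where
    open Alternating alt

    augment : v ∉ image f D → IsMatching G D⁺ (updateAt g u (const v))
    augment v∉f[D] = IsMatching-update G g-matching uv λ w∈D⁺ w≢u →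
      let w∈D⁺-u = x∈p∧x≢y⇒x∈p-y w∈D⁺ w≢u in
      w∈D⁺-u , λ gw≡v → v∉f[D] (subst (_∈ image f D) gw≡v (g-into-f[D] w∈D⁺-u))

    -- Outside the tree g agrees with f, so g x = v and moving u onto v unmatches exactly x.
    alternate : u ∈ R → ∀ {x} → x ∈ D → x ∉ R → f x ≡ v → Alternating (R ∪ ⁅ x ⁆) x
    alternate u∈R {x} x∈D x∉R fx≡v = record
      { g = g′
      ; g-matching = IsMatching-update G g-matching uv (λ w∈ w≢u → D⁺-u w∈ w≢u , gw≢v w∈ w≢u)
      ; g-into-f[D] = into
      ; g-agrees = agrees
      }
      where
      g′ : Fin m → Fin n
      g′ = updateAt g u (const v)
      x≢u : x ≢ u
      x≢u refl = x∉R u∈R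
      x∈D⁺-u : x ∈ D⁺ - u
      x∈D⁺-u = x∈p∧x≢y⇒x∈p-y (p⊆p∪q ⁅ u₀ ⁆ x∈D) x≢u
      D⁺-u : ∀ {w} → w ∈ D⁺ - x → w ≢ u → w ∈ D⁺ - u
      D⁺-u w∈ w≢u = x∈p∧x≢y⇒x∈p-y (p─q⊆p D⁺ ⁅ x ⁆ w∈) w≢u
      gx≡v : g x ≡ v
      gx≡v = trans (g-agrees x∈D x∉R) fx≡v
      gw≢v : ∀ {w} → w ∈ D⁺ - x → w ≢ u → g w ≢ v
      gw≢v w∈ w≢u gw≡v =
        x∈p-y⇒x≢y D⁺ w∈ (injective g-matching (D⁺-u w∈ w≢u) x∈D⁺-u (trans gw≡v (sym gx≡v)))
      into : ∀ {w} → w ∈ D⁺ - x → g′ w ∈ image f D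
      into {w} w∈ with w ≟ u
      ... | yes refl rewrite updateAt-updates u {const v} g =
        subst (_∈ image f D) fx≡v (∈-image⁺ f D x∈D)
      ... | no w≢u rewrite updateAt-minimal w u {const v} g w≢u = g-into-f[D] (D⁺-u w∈ w≢u)
      agrees : ∀ {w} → w ∈ D → w ∉ R ∪ ⁅ x ⁆ → g′ w ≡ f w
      agrees {w} w∈D w∉ =
        trans (updateAt-minimal w u g w≢u) (g-agrees w∈D (λ w∈R → w∉ (p⊆p∪q ⁅ x ⁆ w∈R)))
        where
        w≢u : w ≢ u
        w≢u refl = w∉ (p⊆p∪q ⁅ x ⁆ u∈R)

  tightSet : (t : Tree) → (∀ {u v} → u ∈ R t → G u v ≡ true → v ∈ image f (R t - u₀)) →
    TightSet G
  tightSet t closed = record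
    { U₁ = R t - u₀
    ; match = f
    ; nonempty = proj₁ v₀-matched , proj₁ (proj₂ v₀-matched)
    ; isMatching = IsMatching-⊆ G R-u₀⊆D f-matching
    ; closed = λ u∈ → closed (p─q⊆p (R t) ⁅ u₀ ⁆ u∈)
    }
    where
    v₀-matched : Image f (R t - u₀) v₀
    v₀-matched = ∈-image⁻ f (R t - u₀) (closed (root t) u₀v₀)
    R-u₀⊆D : R t - u₀ ⊆ D
    R-u₀⊆D w∈ = ∈D⁺⇒≢u₀⇒∈D (R⊆D⁺ t (p─q⊆p (R t) ⁅ u₀ ⁆ w∈)) (x∈p-y⇒x≢y (R t) w∈)

  grow : (t : Tree) → ∀ {u v x} → u ∈ R t → G u v ≡ true → v ∉ image f (R t - u₀) →
    x ∈ D → f x ≡ v → ∃ λ t′ → ∣ R t ∣ < ∣ R t′ ∣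
  grow t {u} {v} {x} u∈R uv v∉ x∈D fx≡v = t′ , x∉p⇒∣p∣<∣p∪⁅x⁆∣ x∉R
    where
    x∉R : x ∉ R t
    x∉R x∈R = v∉ (subst (_∈ image f (R t - u₀)) fx≡v
                    (∈-image⁺ f (R t - u₀) (x∈p∧x≢y⇒x∈p-y x∈R (∈D⇒≢u₀ x∈D))))
    widen : ∀ {w} → Alternating (R t) w → Alternating (R t ∪ ⁅ x ⁆) w
    widen a = record
      { g = Alternating.g a
      ; g-matching = Alternating.g-matching a
      ; g-into-f[D] = Alternating.g-into-f[D] a
      ; g-agrees = λ w∈D w∉ → Alternating.g-agrees a w∈D (λ w∈R → w∉ (p⊆p∪q ⁅ x ⁆ w∈R))
      }
    R∪⁅x⁆⊆D⁺ : R t ∪ ⁅ x ⁆ ⊆ D⁺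
    R∪⁅x⁆⊆D⁺ w∈ with x∈p∪q⁻ (R t) ⁅ x ⁆ w∈
    ... | inj₁ w∈R = R⊆D⁺ t w∈R
    ... | inj₂ w∈⁅x⁆ rewrite x∈⁅y⁆⇒x≡y x w∈⁅x⁆ = p⊆p∪q ⁅ u₀ ⁆ x∈D
    alternating′ : ∀ {w} → w ∈ R t ∪ ⁅ x ⁆ → Alternating (R t ∪ ⁅ x ⁆) w
    alternating′ w∈ with x∈p∪q⁻ (R t) ⁅ x ⁆ w∈
    ... | inj₁ w∈R = widen (alternating t w∈R)
    ... | inj₂ w∈⁅x⁆ rewrite x∈⁅y⁆⇒x≡y x w∈⁅x⁆ =
      alternate (alternating t u∈R) uv u∈R x∈D x∉R fx≡v
    t′ : Tree
    t′ = record
      { R = R t ∪ ⁅ x ⁆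
      ; R⊆D⁺ = R∪⁅x⁆⊆D⁺
      ; root = p⊆p∪q ⁅ x ⁆ (root t)
      ; alternating = alternating′
      }

  Exit : Tree → Set
  Exit t = ∃ λ u → ∃ λ v → u ∈ R t × G u v ≡ true × v ∉ image f (R t - u₀)

  exit? : ∀ t → Dec (Exit t)
  exit? t = any? λ u → any? λ v →
    u ∈? R t ×-dec G u v ≟ᵇ true ×-dec ¬? (v ∈? image f (R t - u₀))

  step : (t : Tree) → Outcome ⊎ ∃ λ t′ → ∣ R t ∣ < ∣ R t′ ∣
  step t with exit? t
  ... | no no-exit = inj₁ (inj₂ (tightSet t closed))
    where
    closed : ∀ {u v} → u ∈ R t → G u v ≡ true → v ∈ image f (R t - u₀)
    closed {u} {v} u∈R uv =
      decidable-stable (v ∈? image f (R t - u₀)) (λ v∉ → no-exit (u , v , u∈R , uv , v∉))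
  ... | yes (u , v , u∈R , uv , v∉) with v ∈? image f D
  ...   | no v∉f[D] = inj₁ (inj₁ (_ , augment (alternating t u∈R) uv v∉f[D]))
  ...   | yes v∈f[D] with ∈-image⁻ f D v∈f[D]
  ...     | x , x∈D , fx≡v = inj₂ (grow t u∈R uv v∉ x∈D fx≡v)

  augmentOrTight : Outcome
  augmentOrTight = iterate (λ t → ∣ R t ∣) m (λ t → ∣p∣≤n (R t)) step initial

module _ {m n} (G : BipGraph m n) (hasNeighbour : ∀ u → ∃ λ v → G u v ≡ true) where
  open IsMatching

  PartialMatching : Set
  PartialMatching = Σ (Subset m) λ D → Σ (Fin m → Fin n) λ f → IsMatching G D f

  saturating-or-tight : SaturatingMatching G ⊎ TightSet G
  saturating-or-tight = iterate (λ (D , _) → ∣ D ∣) m (λ (D , _) → ∣p∣≤n D) extend empty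
    where
    empty : PartialMatching
    empty = ⊥ , (λ u → proj₁ (hasNeighbour u)) , record
      { along-edges = λ u∈⊥ → ⊥-elim (∉⊥ u∈⊥)
      ; injective = λ u∈⊥ → ⊥-elim (∉⊥ u∈⊥)
      }
    extend : (P : PartialMatching) →
      (SaturatingMatching G ⊎ TightSet G) ⊎ ∃ λ P′ → ∣ proj₁ P ∣ < ∣ proj₁ P′ ∣
    extend (D , f , M) with nonempty? (∁ D)
    ... | no D-full =
      inj₁ (inj₁ (f , (λ u → along-edges M (∈D u)) , (λ u u′ → injective M (∈D u) (∈D u′))))
      where
      ∈D : ∀ u → u ∈ D
      ∈D u = x∉∁p⇒x∈p (λ u∈∁D → D-full (u , u∈∁D))
    ... | yes (u₀ , u₀∈∁D) with hasNeighbour u₀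
    ...   | v₀ , u₀v₀ with Augmenting.augmentOrTight G D f M u₀ (x∈∁p⇒x∉p u₀∈∁D) v₀ u₀v₀
    ...     | inj₂ T = inj₁ (inj₂ T)
    ...     | inj₁ (h , M′) = inj₂ ((D ∪ ⁅ u₀ ⁆ , h , M′) , x∉p⇒∣p∣<∣p∪⁅x⁆∣ (x∈∁p⇒x∉p u₀∈∁D))

lemmaA1 : {m n : ℕ} (G : BipGraph m n)
    → (∀ u → 1 ≤ degU G u)
    → ¬ SaturatingMatching G
    → Σ (Subset m) λ U₁ → Σ (Subset n) λ V₁ →
        Nonempty U₁ × Nonempty V₁ × PerfectMatchingBetween G U₁ V₁
        × (e G U₁ (allV G) + e G (∁ U₁) V₁ ≤ ∣ U₁ ∣ * ΔV G)
lemmaA1 G deg ¬saturating with saturating-or-tight G (λ u → 1≤∑b2n⇒∃ (G u) (deg u))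
... | inj₁ saturating = ⊥-elim (¬saturating saturating)
... | inj₂ T =
  U₁ , image match U₁ , nonempty , image-nonempty G T , perfectMatchingOntoImage G T , e+e≤∣U₁∣*ΔV G T
  where open TightSet T
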